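{- For every eval-free expression $\mathbf{A}_\alpha$ of $\mathrm{CTT}_{\mathrm{qe}}$, $\vdash\ulcorner\mathbf{A}_\alpha\urcorner=\mathcal{E}(\mathbf{A}_\alpha)$, i.e. this formula is a theorem of $\mathrm{CTT}_{\mathrm{qe}}$.
   Context: SYNTAX. Types: $\iota$, $o$, $\epsilon$, and $(\alpha\to\beta)$ for types $\alpha,\beta$. For each type $\alpha$ there are denumerably many variables $\mathbf{x}_\alpha$. A set $\mathcal{C}$ of typed constants (disjoint from variables) contains the logical constants $=_{\alpha\to\alpha\to o}$, $\mathsf{is\text{ - }var}_{\epsilon\to o}$, $\mathsf{is\text{ - }var}^\alpha_{\epsilon\to o}$, $\mathsf{is\text{ - }con}_{\epsilon\to o}$, $\mathsf{is\text{ - }con}^\alpha_{\epsilon\to o}$, $\mathsf{is\text{ - }expr}_{\epsilon\to o}$, $\mathsf{is\text{ - }expr}^\alpha_{\epsilon\to o}$ (for every $\alpha$), $\mathsf{app}_{\epsilon\to\epsilon\to\epsilon}$, $\mathsf{abs}_{\epsilon\to\epsilon\to\epsilon}$, $\mathsf{quo}_{\epsilon\to\epsilon}$, $\sqsubset_{\epsilon\to\epsilon\to o}$, $\mathsf{is\text{ - }free\text{ - }in}_{\epsilon\to\epsilon\to o}$ (type subscripts are dropped below). Expressions: variables and constants (of their types); $(\mathbf{F}_{\alpha\to\beta}\,\mathbf{A}_\alpha)$ of type $\beta$ (left-associative); $(\lambda\mathbf{x}_\alpha.\mathbf{B}_\beta)$ of type $\alpha\to\beta$; quotations $\ulcorner\mathbf{A}_\alpha\urcorner$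 of type $\epsilon$, only for eval-free $\mathbf{A}_\alpha$; evaluations $[\![\mathbf{A}_\epsilon]\!]_\beta$ of type $\beta$. Eval-free = containing no evaluation; formula = expression of type $o$. In eval-free expressions an occurrence of $\mathbf{x}_\alpha$ is free if it is neither inside a quotation nor inside some $\lambda\mathbf{x}_\alpha.\mathbf{C}$. Constructions: generated from $\ulcorner\mathbf{x}_\alpha\urcorner$, $\ulcorner\mathbf{c}_\alpha\urcorner$ by $\mathsf{app}\,\mathbf{A}\,\mathbf{B}$, $\mathsf{abs}\,\mathbf{A}\,\mathbf{B}$, $\mathsf{quo}\,\mathbf{A}$. $\mathcal{E}$ (from eval-free expressions to constructions): $\mathcal{E}(\mathbf{x})=\ulcorner\mathbf{x}\urcorner$, $\mathcal{E}(\mathbf{c})=\ulcorner\mathbf{c}\urcorner$, $\mathcal{E}(\mathbf{F}\mathbf{A})=\mathsf{app}\,\mathcal{E}(\mathbf{F})\,\mathcal{E}(\mathbf{A})$, $\mathcal{E}(\lambda\mathbf{x}.\mathbf{B})=\mathsf{abs}\,\ulcorner\mathbf{x}\urcorner\,\mathcal{E}(\mathbf{B})$, $\mathcal{E}(\ulcorner\mathbf{A}\urcorner)=\mathsf{quo}\,\mathcal{E}(\mathbf{A})$. Abbreviations: $\mathbf{A}=\mathbf{B}$ is $=\mathbf{A}\,\mathbf{B}$; $\mathbf{A}_o\equiv\mathbf{B}_o$ is $=_{o\to o\to o}\mathbf{A}_o\mathbf{B}_o$; $T_o$ is $(=_{o\to o\to o}\,=\,=_{o\to o\to o})$; $F_o$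 is $(\lambda x_o.T_o)=(\lambda x_o.x_o)$; $\forall\mathbf{x}_\alpha.\mathbf{A}_o$ is $(\lambda\mathbf{x}_\alpha.T_o)=(\lambda\mathbf{x}_\alpha.\mathbf{A}_o)$; $\wedge$ is $\lambda x_o.\lambda y_o.((\lambda g_{o\to o\to o}.g\,T_o\,T_o)=(\lambda g_{o\to o\to o}.g\,x_o\,y_o))$; $\supset$ is $\lambda x_o.\lambda y_o.(x_o=(x_o\wedge y_o))$; $\neg$ is $=_{o\to o\to o}F_o$; $\vee$ is $\lambda x_o.\lambda y_o.\neg(\neg x_o\wedge\neg y_o)$; $\exists\mathbf{x}.\mathbf{A}$ is $\neg\forall\mathbf{x}.\neg\mathbf{A}$; $\mathbf{A}\neq\mathbf{B}$ is $\neg(\mathbf{A}=\mathbf{B})$; $\mathbf{A}\sqsubset\mathbf{B}$ is $\sqsubset\mathbf{A}\,\mathbf{B}$; $\mathrm{IS\text{ - }EFFECTIVE\text{ - }IN}(\mathbf{x}_\alpha,\mathbf{B}_\beta)$ is $\exists\mathbf{y}_\alpha.((\lambda\mathbf{x}_\alpha.\mathbf{B}_\beta)\,\mathbf{y}_\alpha\neq\mathbf{B}_\beta)$ with $\mathbf{y}_\alpha$ distinct from $\mathbf{x}_\alpha$. PROOF SYSTEM (bold letters are schematic; $x_\epsilon,y_\epsilon,z_\epsilon,u_\epsilon,v_\epsilon,f,g,h,p_{\epsilon\to o}$ are fixed variables). A1: $(g_{o\to o}T_o\wedge g_{o\to o}F_o)=\forall x_o.g_{o\to o}x_o$. A2: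 $x_\alpha=y_\alpha\supset h_{\alpha\to o}x_\alpha=h_{\alpha\to o}y_\alpha$. A3: $(f_{\alpha\to\beta}=g_{\alpha\to\beta})=\forall x_\alpha.(f x_\alpha=g x_\alpha)$. A4.1: $(\lambda\mathbf{x}_\alpha.\mathbf{y}_\beta)\mathbf{A}_\alpha=\mathbf{y}_\beta$ ($\mathbf{x},\mathbf{y}$ distinct). A4.2: $(\lambda\mathbf{x}.\mathbf{x})\mathbf{A}=\mathbf{A}$. A4.3: $(\lambda\mathbf{x}.\mathbf{c})\mathbf{A}=\mathbf{c}$. A4.4: $(\lambda\mathbf{x}.(\mathbf{B}\,\mathbf{C}))\mathbf{A}=((\lambda\mathbf{x}.\mathbf{B})\mathbf{A})((\lambda\mathbf{x}.\mathbf{C})\mathbf{A})$. A4.5: $(\lambda\mathbf{x}_\alpha.\lambda\mathbf{y}_\beta.\mathbf{B}_\gamma)\mathbf{A}_\alpha=\lambda\mathbf{y}_\beta.((\lambda\mathbf{x}_\alpha.\mathbf{B}_\gamma)\mathbf{A}_\alpha)$, where $\mathbf{x},\mathbf{y}$ distinct and either $\mathbf{A}$ is eval-free with $\mathbf{y}$ not free in it, or $\mathbf{B}$ is eval-free with $\mathbf{x}$ not free in it. A4.6: $(\lambda\mathbf{x}.\lambda\mathbf{x}.\mathbf{B})\mathbf{A}=\lambda\mathbf{x}.\mathbf{B}$. B1: $\mathsf{is\text{ - }var}^\alpha x_\epsilon\supset\mathsf{is\text{ - }var}\,x_\epsilon$; $\mathsf{is\text{ - }var}^\alpha\ulcorner\mathbf{x}_\alpha\urcorner$;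 $\neg\mathsf{is\text{ - }var}^\alpha\ulcorner\mathbf{x}_\beta\urcorner$ ($\alpha\ne\beta$); $\neg\mathsf{is\text{ - }var}\,\mathbf{A}_\epsilon$ for constructions $\mathbf{A}_\epsilon$ not of the form $\ulcorner\mathbf{x}_\alpha\urcorner$. B2: the same four with $\mathsf{is\text{ - }con}$ and constants $\mathbf{c}$. B3: $\mathsf{is\text{ - }expr}^\alpha x\supset\mathsf{is\text{ - }expr}\,x$; $(\mathsf{is\text{ - }var}^\alpha x\vee\mathsf{is\text{ - }con}^\alpha x)\supset\mathsf{is\text{ - }expr}^\alpha x$; $(\mathsf{is\text{ - }expr}^{\alpha\to\beta}x\wedge\mathsf{is\text{ - }expr}^\alpha y)\supset\mathsf{is\text{ - }expr}^\beta(\mathsf{app}\,x\,y)$; $(\mathsf{is\text{ - }var}^\alpha x\wedge\mathsf{is\text{ - }expr}^\beta y)\supset\mathsf{is\text{ - }expr}^{\alpha\to\beta}(\mathsf{abs}\,x\,y)$; $\mathsf{is\text{ - }expr}\,x\supset\mathsf{is\text{ - }expr}^\epsilon(\mathsf{quo}\,x)$; $(\mathsf{is\text{ - }expr}^\alpha x\wedge\mathsf{is\text{ - }expr}^\beta y)\supset\neg\mathsf{is\text{ - }expr}(\mathsf{app}\,x\,y)$ when $\alpha$ is not of the form $\beta\to\gamma$; $(\neg\mathsf{is\text{ - }expr}\,x\vee\neg\mathsf{is\text{ - }expr}\,y)\supset\neg\mathsf{is\text{ - }expr}(\mathsf{app}\,x\,y)$; $(\neg\mathsf{is\text{ - }var}\,x\vee\neg\mathsf{is\text{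 - }expr}\,y)\supset\neg\mathsf{is\text{ - }expr}(\mathsf{abs}\,x\,y)$; $\neg\mathsf{is\text{ - }expr}\,x\supset\neg\mathsf{is\text{ - }expr}(\mathsf{quo}\,x)$ (here $x,y$ mean $x_\epsilon,y_\epsilon$). B4: $\mathsf{is\text{ - }var}\,x\supset(\neg\mathsf{is\text{ - }con}\,x\wedge x\ne\mathsf{app}\,y\,z\wedge x\ne\mathsf{abs}\,y\,z\wedge x\ne\mathsf{quo}\,y)$; $\mathsf{is\text{ - }con}\,x\supset(\neg\mathsf{is\text{ - }var}\,x\wedge x\ne\mathsf{app}\,y\,z\wedge x\ne\mathsf{abs}\,y\,z\wedge x\ne\mathsf{quo}\,y)$; $x=\mathsf{app}\,y\,z\supset(\neg\mathsf{is\text{ - }var}\,x\wedge\neg\mathsf{is\text{ - }con}\,x\wedge x\ne\mathsf{abs}\,u\,v\wedge x\ne\mathsf{quo}\,u)$; $x=\mathsf{abs}\,y\,z\supset(\neg\mathsf{is\text{ - }var}\,x\wedge\neg\mathsf{is\text{ - }con}\,x\wedge x\ne\mathsf{app}\,u\,v\wedge x\ne\mathsf{quo}\,u)$; $x=\mathsf{quo}\,y\supset(\neg\mathsf{is\text{ - }var}\,x\wedge\neg\mathsf{is\text{ - }con}\,x\wedge x\ne\mathsf{app}\,u\,v\wedge x\ne\mathsf{abs}\,u\,v)$; $\ulcorner\mathbf{x}_\alpha\urcorner\ne\ulcorner\mathbf{y}_\beta\urcorner$ for distinct variables; $\ulcorner\mathbf{c}_\alpha\urcorner\ne\ulcorner\mathbf{d}_\beta\urcorner$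 for distinct constants; $\mathsf{app}\,x\,y=\mathsf{app}\,u\,v\supset(x=u\wedge y=v)$; $\mathsf{abs}\,x\,y=\mathsf{abs}\,u\,v\supset(x=u\wedge y=v)$; $\mathsf{quo}\,x=\mathsf{quo}\,u\supset x=u$. B5: $x\sqsubset\mathsf{app}\,x\,y$; $x\sqsubset\mathsf{app}\,y\,x$; $x\sqsubset\mathsf{abs}\,x\,y$; $x\sqsubset\mathsf{abs}\,y\,x$; $x\sqsubset\mathsf{quo}\,x$; $(x\sqsubset y\wedge y\sqsubset z)\supset x\sqsubset z$. B6: $\forall u_\epsilon.(\forall v_\epsilon.(v_\epsilon\sqsubset u_\epsilon\supset p\,v_\epsilon)\supset p\,u_\epsilon)\supset\forall u_\epsilon.p\,u_\epsilon$. B7: $\mathsf{is\text{ - }var}\,x\supset\mathsf{is\text{ - }free\text{ - }in}\,x\,x$; $(\mathsf{is\text{ - }var}\,x\wedge\mathsf{is\text{ - }var}\,y\wedge x\ne y)\supset\neg\mathsf{is\text{ - }free\text{ - }in}\,x\,y$; $(\mathsf{is\text{ - }var}\,x\wedge\mathsf{is\text{ - }con}\,y)\supset\neg\mathsf{is\text{ - }free\text{ - }in}\,x\,y$; $(\mathsf{is\text{ - }var}\,x\wedge\mathsf{is\text{ - }expr}(\mathsf{app}\,y\,z))\supset(\mathsf{is\text{ - }free\text{ - }in}\,x\,(\mathsf{app}\,y\,z)\equiv(\mathsf{is\text{ - }free\text{ - }in}\,x\,y\vee\mathsf{is\text{ - }free\text{ - }in}\,x\,z))$; $(\mathsf{is\text{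 - }var}\,x\wedge\mathsf{is\text{ - }expr}(\mathsf{abs}\,y\,z)\wedge x\ne y)\supset(\mathsf{is\text{ - }free\text{ - }in}\,x\,(\mathsf{abs}\,y\,z)\equiv\mathsf{is\text{ - }free\text{ - }in}\,x\,z)$; $\mathsf{is\text{ - }expr}(\mathsf{abs}\,x\,y)\supset\neg\mathsf{is\text{ - }free\text{ - }in}\,x\,(\mathsf{abs}\,x\,y)$; $(\mathsf{is\text{ - }var}\,x\wedge\mathsf{is\text{ - }expr}\,y)\supset\neg\mathsf{is\text{ - }free\text{ - }in}\,x\,(\mathsf{quo}\,y)$; $(\neg\mathsf{is\text{ - }var}\,x\vee\neg\mathsf{is\text{ - }expr}\,y)\supset\neg\mathsf{is\text{ - }free\text{ - }in}\,x\,y$. B8: $\ulcorner\mathbf{F}\,\mathbf{A}\urcorner=\mathsf{app}\,\ulcorner\mathbf{F}\urcorner\,\ulcorner\mathbf{A}\urcorner$; $\ulcorner\lambda\mathbf{x}.\mathbf{B}\urcorner=\mathsf{abs}\,\ulcorner\mathbf{x}\urcorner\,\ulcorner\mathbf{B}\urcorner$; $\ulcorner\ulcorner\mathbf{A}\urcorner\urcorner=\mathsf{quo}\,\ulcorner\mathbf{A}\urcorner$. B9: $(\lambda\mathbf{x}_\alpha.\ulcorner\mathbf{B}_\beta\urcorner)\mathbf{A}_\alpha=\ulcorner\mathbf{B}_\beta\urcorner$. B10: $[\![\ulcorner\mathbf{x}_\alpha\urcorner]\!]_\alpha=\mathbf{x}_\alpha$; $[\![\ulcorner\mathbf{c}_\alpha\urcorner]\!]_\alpha=\mathbf{c}_\alpha$;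 $(\mathsf{is\text{ - }expr}^{\alpha\to\beta}\mathbf{A}_\epsilon\wedge\mathsf{is\text{ - }expr}^\alpha\mathbf{B}_\epsilon)\supset[\![\mathsf{app}\,\mathbf{A}_\epsilon\,\mathbf{B}_\epsilon]\!]_\beta=[\![\mathbf{A}_\epsilon]\!]_{\alpha\to\beta}[\![\mathbf{B}_\epsilon]\!]_\alpha$; $(\mathsf{is\text{ - }expr}^\beta\mathbf{A}_\epsilon\wedge\neg\mathsf{is\text{ - }free\text{ - }in}\,\ulcorner\mathbf{x}_\alpha\urcorner\,\ulcorner\mathbf{A}_\epsilon\urcorner)\supset[\![\mathsf{abs}\,\ulcorner\mathbf{x}_\alpha\urcorner\,\mathbf{A}_\epsilon]\!]_{\alpha\to\beta}=\lambda\mathbf{x}_\alpha.[\![\mathbf{A}_\epsilon]\!]_\beta$; $\mathsf{is\text{ - }expr}^\epsilon\mathbf{A}_\epsilon\supset[\![\mathsf{quo}\,\mathbf{A}_\epsilon]\!]_\epsilon=\mathbf{A}_\epsilon$. B11: $(\lambda\mathbf{x}_\alpha.[\![\mathbf{B}_\epsilon]\!]_\beta)\mathbf{x}_\alpha=[\![\mathbf{B}_\epsilon]\!]_\beta$; $(\mathsf{is\text{ - }expr}^\beta((\lambda\mathbf{x}_\alpha.\mathbf{B}_\epsilon)\mathbf{A}_\alpha)\wedge\neg\mathsf{is\text{ - }free\text{ - }in}\,\ulcorner\mathbf{x}_\alpha\urcorner\,((\lambda\mathbf{x}_\alpha.\mathbf{B}_\epsilon)\mathbf{A}_\alpha))\supset(\lambda\mathbf{x}_\alpha.[\![\mathbf{B}_\epsilon]\!]_\beta)\mathbf{A}_\alpha=[\![(\lambda\mathbf{x}_\alpha.\mathbf{B}_\epsilon)\mathbf{A}_\alpha]\!]_\beta$.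 B12: $\neg\mathrm{IS\text{ - }EFFECTIVE\text{ - }IN}(\mathbf{x}_\alpha,\mathbf{B}_\beta)$ where $\mathbf{B}_\beta$ is eval-free and $\mathbf{x}_\alpha$ not free in it. B13: $(\neg\mathrm{IS\text{ - }EFFECTIVE\text{ - }IN}(\mathbf{y}_\beta,\mathbf{A}_\alpha)\vee\neg\mathrm{IS\text{ - }EFFECTIVE\text{ - }IN}(\mathbf{x}_\alpha,\mathbf{B}_\gamma))\supset(\lambda\mathbf{x}_\alpha.\lambda\mathbf{y}_\beta.\mathbf{B}_\gamma)\mathbf{A}_\alpha=\lambda\mathbf{y}_\beta.((\lambda\mathbf{x}_\alpha.\mathbf{B}_\gamma)\mathbf{A}_\alpha)$, $\mathbf{x},\mathbf{y}$ distinct. Rule R: from $\mathbf{A}_\alpha=\mathbf{B}_\alpha$ and $\mathbf{C}_o$ infer the result of replacing one occurrence of $\mathbf{A}_\alpha$ in $\mathbf{C}_o$ by $\mathbf{B}_\alpha$, provided the occurrence is not within a quotation, not the bound variable of a $\lambda$, and not the type-indicating second argument of an evaluation. A theorem of $\mathrm{CTT}_{\mathrm{qe}}$ ($\vdash\mathbf{A}_o$) is the last line of a finite sequence of formulas each of which is an axiom or follows from earlier ones by Rule R. -}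

module Defs where

open import Data.Nat using (ℕ; zero; suc)
open import Data.Product using (Σ; _×_; _,_)
open import Data.Sum using (_⊎_)
open import Data.Unit using (⊤)
open import Data.Empty using (⊥)
open import Relation.Nullary using (¬_)
open import Relation.Binary.PropositionalEquality using (_≡_; _≢_)

data Ty : Set where
  ι o ε : Ty
  _⇒_   : Ty → Ty → Ty

infixr 7 _⇒_

-- The whole development is parametrised by a family NL of
-- non-logical constants (the part of the constant set 𝒞 beyond the
-- logical constants).  A variable  x_α  is  V i α  with i : ℕ
-- (denumerably many variables of each type); variables V i α and V j β
-- are the same variable iff (i , α) ≡ (j , β).

module CTT (NL : Ty → Set) where

  data Con : Ty → Set where
    cEq      : (α : Ty) → Con (α ⇒ α ⇒ o)
    cIsVar   : Con (ε ⇒ o)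
    cIsVarT  : (α : Ty) → Con (ε ⇒ o)
    cIsCon   : Con (ε ⇒ o)
    cIsConT  : (α : Ty) → Con (ε ⇒ o)
    cIsExpr  : Con (ε ⇒ o)
    cIsExprT : (α : Ty) → Con (ε ⇒ o)
    cApp     : Con (ε ⇒ ε ⇒ ε)
    cAbs     : Con (ε ⇒ ε ⇒ ε)
    cQuo     : Con (ε ⇒ ε)
    cSub     : Con (ε ⇒ ε ⇒ o)
    cFreeIn  : Con (ε ⇒ ε ⇒ o)
    nl       : ∀ {α} → NL α → Con α

  -- Expressions.  Mode ef = eval-free expressions, full = all expressions.
  -- Quotation is only formed from eval-free expressions.
  data Mode : Set where
    ef full : Mode

  data Expr : Mode → Ty → Set where
    V     : ∀ {m} → ℕ → (α : Ty) → Expr m α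
    K     : ∀ {m α} → Con α → Expr m α
    _·_   : ∀ {m α β} → Expr m (α ⇒ β) → Expr m α → Expr m β
    ƛ     : ∀ {m β} → ℕ → (α : Ty) → Expr m β → Expr m (α ⇒ β)
    ⌜_⌝   : ∀ {m α} → Expr ef α → Expr m ε
    ⟦_⟧_  : Expr full ε → (β : Ty) → Expr full β

  infixl 9 _·_

  ↑ : ∀ {α} → Expr ef α → Expr full α
  ↑ (V i α)   = V i α
  ↑ (K c)     = K c
  ↑ (F · A)   = ↑ F · ↑ A
  ↑ (ƛ i α B) = ƛ i α (↑ B)
  ↑ ⌜ A ⌝     = ⌜ A ⌝

  EvalFree : ∀ {m α} → Expr m α → Set
  EvalFree (V i α)   = ⊤
  EvalFree (K c)     = ⊤
  EvalFree (F · A)   = EvalFree F × EvalFree A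
  EvalFree (ƛ i α B) = EvalFree B
  EvalFree ⌜ A ⌝     = ⊤
  EvalFree (⟦ A ⟧ β) = ⊥

  -- free occurrence of x_α (= V i α): not inside a quotation and not
  -- inside some λ x_α. (Only used for eval-free expressions; the
  -- evaluation clause is irrelevant there.)
  FreeIn : ∀ {m β} → ℕ → Ty → Expr m β → Set
  FreeIn i α (V j β)   = (i , α) ≡ (j , β)
  FreeIn i α (K c)     = ⊥
  FreeIn i α (F · A)   = FreeIn i α F ⊎ FreeIn i α A
  FreeIn i α (ƛ j β B) = ((i , α) ≢ (j , β)) × FreeIn i α B
  FreeIn i α ⌜ A ⌝     = ⊥
  FreeIn i α (⟦ A ⟧ β) = FreeIn i α A

  ℰ : ∀ {α} → Expr ef α → Expr full ε
  ℰ (V i α)   = ⌜ V i α ⌝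
  ℰ (K c)     = ⌜ K c ⌝
  ℰ (F · A)   = K cApp · ℰ F · ℰ A
  ℰ (ƛ i α B) = K cAbs · ⌜ V i α ⌝ · ℰ B
  ℰ ⌜ A ⌝     = K cQuo · ℰ A

  data IsConstr : Expr full ε → Set where
    qvar : ∀ i α → IsConstr ⌜ V i α ⌝
    qcon : ∀ {α} (c : Con α) → IsConstr ⌜ K c ⌝
    capp : ∀ {A B} → IsConstr A → IsConstr B → IsConstr (K cApp · A · B)
    cabs : ∀ {A B} → IsConstr A → IsConstr B → IsConstr (K cAbs · A · B)
    cquo : ∀ {A} → IsConstr A → IsConstr (K cQuo · A)

  E : Ty → Set
  E = Expr full

  infix 8 _≐_ _≠̇_ _⊏_
  infix 3 _≡̇_
  _≐_ : ∀ {α} → E α → E α → E o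
  A ≐ B = K (cEq _) · A · B

  Tᵒ : E o
  Tᵒ = K (cEq (o ⇒ o ⇒ o)) · K (cEq o) · K (cEq o)

  Fᵒ : E o
  Fᵒ = ƛ 0 o Tᵒ ≐ ƛ 0 o (V 0 o)

  All : ℕ → (α : Ty) → E o → E o
  All i α A = ƛ i α Tᵒ ≐ ƛ i α A

  ∧c : E (o ⇒ o ⇒ o)
  ∧c = ƛ 0 o (ƛ 1 o (ƛ 6 (o ⇒ o ⇒ o) (V 6 (o ⇒ o ⇒ o) · Tᵒ · Tᵒ)
                    ≐ ƛ 6 (o ⇒ o ⇒ o) (V 6 (o ⇒ o ⇒ o) · V 0 o · V 1 o)))

  infixr 6 _∧̇_
  infixr 5 _∨̇_
  infixr 4 _⊃̇_
  _∧̇_ : E o → E o → E o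
  A ∧̇ B = ∧c · A · B

  ⊃c : E (o ⇒ o ⇒ o)
  ⊃c = ƛ 0 o (ƛ 1 o (V 0 o ≐ (V 0 o ∧̇ V 1 o)))

  _⊃̇_ : E o → E o → E o
  A ⊃̇ B = ⊃c · A · B

  ¬c : E (o ⇒ o)
  ¬c = K (cEq o) · Fᵒ

  Not : E o → E o
  Not A = ¬c · A

  ∨c : E (o ⇒ o ⇒ o)
  ∨c = ƛ 0 o (ƛ 1 o (Not (Not (V 0 o) ∧̇ Not (V 1 o))))

  _∨̇_ : E o → E o → E o
  A ∨̇ B = ∨c · A · B

  Ex : ℕ → (α : Ty) → E o → E o
  Ex i α A = Not (All i α (Not A))

  _≠̇_ : ∀ {α} → E α → E α → E o
  A ≠̇ B = Not (A ≐ B)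

  _≡̇_ : E o → E o → E o
  A ≡̇ B = A ≐ B

  _⊏_ : E ε → E ε → E o
  A ⊏ B = K cSub · A · B

  -- IS-EFFECTIVE-IN(x_α, B_β), with the auxiliary variable y_α = V j α
  -- (required to be distinct from x_α = V i α)
  IsEffIn : ∀ {β} (i : ℕ) (α : Ty) (j : ℕ) → E β → E o
  IsEffIn i α j B = Ex j α ((ƛ i α B · V j α) ≠̇ B)

  isVar isCon isExpr : E ε → E o
  isVar A  = K cIsVar · A
  isCon A  = K cIsCon · A
  isExpr A = K cIsExpr · A
  isVarT isConT isExprT : Ty → E ε → E o
  isVarT α A  = K (cIsVarT α) · A
  isConT α A  = K (cIsConT α) · A
  isExprT α A = K (cIsExprT α) · A
  app abs : E ε → E ε → E ε
  app A B = K cApp · A · B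
  abs A B = K cAbs · A · B
  quo : E ε → E ε
  quo A = K cQuo · A
  freeIn : E ε → E ε → E o
  freeIn A B = K cFreeIn · A · B

  xε yε zε uε vε : E ε
  xε = V 0 ε
  yε = V 1 ε
  zε = V 2 ε
  uε = V 3 ε
  vε = V 4 ε
  pv : E (ε ⇒ o)
  pv = V 8 (ε ⇒ o)

  data Axiom : E o → Set where
    A1   : let g = V 6 (o ⇒ o) in
           Axiom ((g · Tᵒ ∧̇ g · Fᵒ) ≐ All 0 o (g · V 0 o))
    A2   : ∀ α → let h = V 7 (α ⇒ o) ; x = V 0 α ; y = V 1 α in
           Axiom ((x ≐ y) ⊃̇ (h · x ≐ h · y))
    A3   : ∀ α β → let f = V 5 (α ⇒ β) ; g = V 6 (α ⇒ β) ; x = V 0 α in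
           Axiom ((f ≐ g) ≐ All 0 α (f · x ≐ g · x))
    A4-1 : ∀ i α j β (A : E α) → (i , α) ≢ (j , β) →
           Axiom ((ƛ i α (V j β) · A) ≐ V j β)
    A4-2 : ∀ i α (A : E α) → Axiom ((ƛ i α (V i α) · A) ≐ A)
    A4-3 : ∀ i α {β} (c : Con β) (A : E α) →
           Axiom ((ƛ i α (K c) · A) ≐ K c)
    A4-4 : ∀ i α {β γ} (B : E (β ⇒ γ)) (C : E β) (A : E α) →
           Axiom ((ƛ i α (B · C) · A) ≐ ((ƛ i α B · A) · (ƛ i α C · A)))
    A4-5 : ∀ i α j β {γ} (B : E γ) (A : E α) → (i , α) ≢ (j , β) →
           (EvalFree A × ¬ FreeIn j β A) ⊎ (EvalFree B × ¬ FreeIn i α B) →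
           Axiom ((ƛ i α (ƛ j β B) · A) ≐ ƛ j β (ƛ i α B · A))
    A4-6 : ∀ i α {γ} (B : E γ) (A : E α) →
           Axiom ((ƛ i α (ƛ i α B) · A) ≐ ƛ i α B)
    B1-1 : ∀ α → Axiom (isVarT α xε ⊃̇ isVar xε)
    B1-2 : ∀ i α → Axiom (isVarT α ⌜ V i α ⌝)
    B1-3 : ∀ i α β → α ≢ β → Axiom (Not (isVarT α ⌜ V i β ⌝))
    B1-4 : ∀ (A : E ε) → IsConstr A → (∀ i α → A ≢ ⌜ V i α ⌝) →
           Axiom (Not (isVar A))
    B2-1 : ∀ α → Axiom (isConT α xε ⊃̇ isCon xε)
    B2-2 : ∀ α (c : Con α) → Axiom (isConT α ⌜ K c ⌝)
    B2-3 : ∀ α β (c : Con β) → α ≢ β → Axiom (Not (isConT α ⌜ K c ⌝))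
    B2-4 : ∀ (A : E ε) → IsConstr A →
           (∀ α (c : Con α) → A ≢ ⌜ K c ⌝) → Axiom (Not (isCon A))
    B3-1 : ∀ α → Axiom (isExprT α xε ⊃̇ isExpr xε)
    B3-2 : ∀ α → Axiom ((isVarT α xε ∨̇ isConT α xε) ⊃̇ isExprT α xε)
    B3-3 : ∀ α β → Axiom ((isExprT (α ⇒ β) xε ∧̇ isExprT α yε)
                          ⊃̇ isExprT β (app xε yε))
    B3-4 : ∀ α β → Axiom ((isVarT α xε ∧̇ isExprT β yε)
                          ⊃̇ isExprT (α ⇒ β) (abs xε yε))
    B3-5 : Axiom (isExpr xε ⊃̇ isExprT ε (quo xε))
    B3-6 : ∀ α β → (∀ γ → α ≢ (β ⇒ γ)) →
           Axiom ((isExprT α xε ∧̇ isExprT β yε) ⊃̇ Not (isExpr (app xε yε)))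
    B3-7 : Axiom ((Not (isExpr xε) ∨̇ Not (isExpr yε)) ⊃̇ Not (isExpr (app xε yε)))
    B3-8 : Axiom ((Not (isVar xε) ∨̇ Not (isExpr yε)) ⊃̇ Not (isExpr (abs xε yε)))
    B3-9 : Axiom (Not (isExpr xε) ⊃̇ Not (isExpr (quo xε)))
    B4-1 : Axiom (isVar xε ⊃̇ (Not (isCon xε) ∧̇ xε ≠̇ app yε zε
                               ∧̇ xε ≠̇ abs yε zε ∧̇ xε ≠̇ quo yε))
    B4-2 : Axiom (isCon xε ⊃̇ (Not (isVar xε) ∧̇ xε ≠̇ app yε zε
                               ∧̇ xε ≠̇ abs yε zε ∧̇ xε ≠̇ quo yε))
    B4-3 : Axiom ((xε ≐ app yε zε) ⊃̇ (Not (isVar xε) ∧̇ Not (isCon xε)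
                               ∧̇ xε ≠̇ abs uε vε ∧̇ xε ≠̇ quo uε))
    B4-4 : Axiom ((xε ≐ abs yε zε) ⊃̇ (Not (isVar xε) ∧̇ Not (isCon xε)
                               ∧̇ xε ≠̇ app uε vε ∧̇ xε ≠̇ quo uε))
    B4-5 : Axiom ((xε ≐ quo yε) ⊃̇ (Not (isVar xε) ∧̇ Not (isCon xε)
                               ∧̇ xε ≠̇ app uε vε ∧̇ xε ≠̇ abs uε vε))
    B4-6 : ∀ i α j β → (i , α) ≢ (j , β) →
           Axiom (_≠̇_ {ε} ⌜ V i α ⌝ ⌜ V j β ⌝)
    B4-7 : ∀ α (c : Con α) β (d : Con β) →
           _≢_ {A = Σ Ty Con} (α , c) (β , d) →
           Axiom (_≠̇_ {ε} ⌜ K c ⌝ ⌜ K d ⌝)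
    B4-8 : Axiom ((app xε yε ≐ app uε vε) ⊃̇ ((xε ≐ uε) ∧̇ (yε ≐ vε)))
    B4-9 : Axiom ((abs xε yε ≐ abs uε vε) ⊃̇ ((xε ≐ uε) ∧̇ (yε ≐ vε)))
    B4-10 : Axiom ((quo xε ≐ quo uε) ⊃̇ (xε ≐ uε))
    B5-1 : Axiom (xε ⊏ app xε yε)
    B5-2 : Axiom (xε ⊏ app yε xε)
    B5-3 : Axiom (xε ⊏ abs xε yε)
    B5-4 : Axiom (xε ⊏ abs yε xε)
    B5-5 : Axiom (xε ⊏ quo xε)
    B5-6 : Axiom (((xε ⊏ yε) ∧̇ (yε ⊏ zε)) ⊃̇ (xε ⊏ zε))
    B6   : Axiom (All 3 ε (All 4 ε ((vε ⊏ uε) ⊃̇ pv · vε) ⊃̇ pv · uε)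
                  ⊃̇ All 3 ε (pv · uε))
    B7-1 : Axiom (isVar xε ⊃̇ freeIn xε xε)
    B7-2 : Axiom ((isVar xε ∧̇ isVar yε ∧̇ xε ≠̇ yε) ⊃̇ Not (freeIn xε yε))
    B7-3 : Axiom ((isVar xε ∧̇ isCon yε) ⊃̇ Not (freeIn xε yε))
    B7-4 : Axiom ((isVar xε ∧̇ isExpr (app yε zε))
                  ⊃̇ (freeIn xε (app yε zε) ≡̇ (freeIn xε yε ∨̇ freeIn xε zε)))
    B7-5 : Axiom ((isVar xε ∧̇ isExpr (abs yε zε) ∧̇ xε ≠̇ yε)
                  ⊃̇ (freeIn xε (abs yε zε) ≡̇ freeIn xε zε))
    B7-6 : Axiom (isExpr (abs xε yε) ⊃̇ Not (freeIn xε (abs xε yε)))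
    B7-7 : Axiom ((isVar xε ∧̇ isExpr yε) ⊃̇ Not (freeIn xε (quo yε)))
    B7-8 : Axiom ((Not (isVar xε) ∨̇ Not (isExpr yε)) ⊃̇ Not (freeIn xε yε))
    B8-1 : ∀ {α β} (F : Expr ef (α ⇒ β)) (A : Expr ef α) →
           Axiom (_≐_ {ε} ⌜ F · A ⌝ (app ⌜ F ⌝ ⌜ A ⌝))
    B8-2 : ∀ i α {β} (B : Expr ef β) →
           Axiom (_≐_ {ε} ⌜ ƛ i α B ⌝ (abs ⌜ V i α ⌝ ⌜ B ⌝))
    B8-3 : ∀ {α} (A : Expr ef α) →
           Axiom (_≐_ {ε} ⌜ ⌜ A ⌝ ⌝ (quo ⌜ A ⌝))
    B9   : ∀ i α {β} (B : Expr ef β) (A : E α) →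
           Axiom ((ƛ i α ⌜ B ⌝ · A) ≐ ⌜ B ⌝)
    B10-1 : ∀ i α → Axiom ((⟦ ⌜ V i α ⌝ ⟧ α) ≐ V i α)
    B10-2 : ∀ α (c : Con α) → Axiom ((⟦ ⌜ K c ⌝ ⟧ α) ≐ K c)
    B10-3 : ∀ α β (A B : E ε) →
            Axiom ((isExprT (α ⇒ β) A ∧̇ isExprT α B)
                   ⊃̇ ((⟦ app A B ⟧ β) ≐ ((⟦ A ⟧ (α ⇒ β)) · (⟦ B ⟧ α))))
    B10-4 : ∀ i α β (A : Expr ef ε) →
            Axiom ((isExprT β (↑ A) ∧̇ Not (freeIn ⌜ V i α ⌝ ⌜ A ⌝))
                   ⊃̇ ((⟦ abs ⌜ V i α ⌝ (↑ A) ⟧ (α ⇒ β)) ≐ ƛ i α (⟦ ↑ A ⟧ β)))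
    B10-5 : ∀ (A : E ε) →
            Axiom (isExprT ε A ⊃̇ ((⟦ quo A ⟧ ε) ≐ A))
    B11-1 : ∀ i α β (B : E ε) →
            Axiom ((ƛ i α (⟦ B ⟧ β) · V i α) ≐ (⟦ B ⟧ β))
    B11-2 : ∀ i α β (B : E ε) (A : E α) →
            Axiom ((isExprT β (ƛ i α B · A)
                    ∧̇ Not (freeIn ⌜ V i α ⌝ (ƛ i α B · A)))
                   ⊃̇ ((ƛ i α (⟦ B ⟧ β) · A) ≐ (⟦ ƛ i α B · A ⟧ β)))
    B12   : ∀ i α j {β} (B : E β) → (i , α) ≢ (j , α) →
            EvalFree B → ¬ FreeIn i α B →
            Axiom (Not (IsEffIn i α j B))
    B13   : ∀ i α j β {γ} (A : E α) (B : E γ) → (i , α) ≢ (j , β) →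
            ∀ k → (j , β) ≢ (k , β) → ∀ l → (i , α) ≢ (l , α) →
            Axiom ((Not (IsEffIn j β k A) ∨̇ Not (IsEffIn i α l B))
                   ⊃̇ ((ƛ i α (ƛ j β B) · A) ≐ ƛ j β (ƛ i α B · A)))

  -- Rule R: one-hole contexts not entering quotations (λ-binders and the
  -- type argument of an evaluation are not expressions, so they can
  -- never be the replaced occurrence).

  data Ctx (α : Ty) : Ty → Set where
    hole  : Ctx α α
    appL  : ∀ {β γ} → Ctx α (β ⇒ γ) → E β → Ctx α γ
    appR  : ∀ {β γ} → E (β ⇒ γ) → Ctx α β → Ctx α γ
    lamC  : ∀ {γ} → ℕ → (β : Ty) → Ctx α γ → Ctx α (β ⇒ γ)
    evalC : Ctx α ε → (β : Ty) → Ctx α β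

  plug : ∀ {α β} → Ctx α β → E α → E β
  plug hole         A = A
  plug (appL C B)   A = plug C A · B
  plug (appR F C)   A = F · plug C A
  plug (lamC i β C) A = ƛ i β (plug C A)
  plug (evalC C β)  A = ⟦ plug C A ⟧ β

  infix 2 ⊢_
  data ⊢_ : E o → Set where
    axiom : ∀ {A} → Axiom A → ⊢ A
    ruleR : ∀ {α} {A B : E α} (C : Ctx α o) →
            ⊢ (A ≐ B) → ⊢ plug C A → ⊢ plug C B

-- By structural induction on A: axiom B8 unfolds the quotation of a compound
-- expression by one layer, and Rule R then replaces the quotations of the
-- immediate subexpressions by their constructions (induction hypothesis).
-- Variables and constants need only reflexivity of equality.
module Submission where

open import Defs

module _ (NL : Ty → Set) where
  open CTT NL

  -- Rule R applied to the left-hand side of A4.2 inside A4.2 itself.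
  ≐-refl : ∀ {α} (X : E α) → ⊢ X ≐ X
  ≐-refl {α} X = ruleR (appL (appR (K (cEq α)) hole) X) (axiom identity-β) (axiom identity-β)
    where identity-β = A4-2 0 α X

  rewrite-rhs : ∀ {α β} {X : E β} {A B : E α} (C : Ctx α β) →
                ⊢ A ≐ B → ⊢ X ≐ plug C A → ⊢ X ≐ plug C B
  rewrite-rhs {X = X} C = ruleR (appR (K (cEq _) · X) C)

  quotation≐construction : ∀ {α} (A : Expr ef α) → ⊢ _≐_ {ε} ⌜ A ⌝ (ℰ A)
  quotation≐construction (V i α) = ≐-refl ⌜ V i α ⌝
  quotation≐construction (K c)   = ≐-refl ⌜ K c ⌝
  quotation≐construction (F · A) =
    rewrite-rhs (appR (K cApp · ℰ F) hole) (quotation≐construction A)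
      (rewrite-rhs (appL (appR (K cApp) hole) ⌜ A ⌝) (quotation≐construction F)
        (axiom (B8-1 F A)))
  quotation≐construction (ƛ i α B) =
    rewrite-rhs (appR (K cAbs · ⌜ V i α ⌝) hole) (quotation≐construction B)
      (axiom (B8-2 i α B))
  quotation≐construction ⌜ A ⌝ =
    rewrite-rhs (appR (K cQuo) hole) (quotation≐construction A)
      (axiom (B8-3 A))

mainTheorem7 : (NL : Ty → Set) → let open CTT NL in
    ∀ {α} (A : Expr ef α) → ⊢ _≐_ {ε} ⌜ A ⌝ (ℰ A)
mainTheorem7 = quotation≐construction
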